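{- There exists a graph $G$ such that, for any locality-aware healing algorithm on $G$, there exists an adversary deletion strategy that forces some node to increase its degree by $\log\log n$, where $n$ is the number of nodes in $G$.
   Context: Model: the network is a connected undirected graph. An adversary deletes nodes one at a time. After each deletion of a node $x$, the healing algorithm must keep the network connected by adding edges. A healing algorithm is locality-aware if the edges it adds after deleting $x$ join only pairs of nodes that were neighbours of $x$. The degree increase of a node is its current degree minus its degree in the original graph. -}

module Defs where

open import Data.Nat using (ℕ)
open import Data.Bool using (Bool; true; false; _∧_; _∨_; not)
open import Data.Fin using (Fin)
open import Data.Fin.Properties using (_≟_)
open import Data.List using (List; []; _∷_; length; filterᵇ; allFin)
open import Data.Product using (_×_)
open import Data.Unit using (⊤)
open import Relation.Binary.PropositionalEquality using (_≡_; _≢_)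
open import Relation.Nullary.Decidable using (⌊_⌋)

Adj : ℕ → Set
Adj n = Fin n → Fin n → Bool

Symmetric : ∀ {n} → Adj n → Set
Symmetric {n} G = ∀ (u v : Fin n) → G u v ≡ G v u

Irreflexive : ∀ {n} → Adj n → Set
Irreflexive {n} G = ∀ (u : Fin n) → G u u ≡ false

-- The actual edges are those of the raw relation between surviving nodes
-- (deleting a node deletes all its incident edges).
record Network (n : ℕ) : Set where
  field
    alive : Fin n → Bool
    adj   : Adj n
open Network public

E : ∀ {n} → Network n → Fin n → Fin n → Bool
E s u v = alive s u ∧ alive s v ∧ adj s u v

data Reach {n : ℕ} (s : Network n) : Fin n → Fin n → Set where
  here : ∀ {u} → Reach s u u
  step : ∀ {u v w} → E s u v ≡ true → Reach s v w → Reach s u w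

Connected : ∀ {n} → Network n → Set
Connected {n} s = ∀ (u v : Fin n) → alive s u ≡ true → alive s v ≡ true → Reach s u v

degree : ∀ {n} → Network n → Fin n → ℕ
degree {n} s v = length (filterᵇ (E s v) (allFin n))

degreeG : ∀ {n} → Adj n → Fin n → ℕ
degreeG {n} G v = length (filterᵇ (G v) (allFin n))

initial : ∀ {n} → Adj n → Network n
initial G = record { alive = λ _ → true ; adj = G }

-- A (deterministic) healing algorithm: given the history of deletions so
-- far (most recent first) and the node x now being deleted, it returns the
-- set of edges {u,w} it adds (as a predicate; the added edges are
-- symmetrised).
Healer : ℕ → Set
Healer n = List (Fin n) → Fin n → Adj n

deleteAndHeal : ∀ {n} → Network n → Fin n → Adj n → Network n
deleteAndHeal s x add = record
  { alive = λ y → alive s y ∧ not ⌊ y ≟ x ⌋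
  ; adj   = λ u w → adj s u w ∨ add u w ∨ add w u
  }

run : ∀ {n} → Adj n → Healer n → List (Fin n) → Network n
run G A []      = initial G
run G A (x ∷ h) = deleteAndHeal (run G A h) x (A h x)

Valid : ∀ {n} → Adj n → Healer n → List (Fin n) → Set
Valid G A []      = ⊤
Valid G A (x ∷ h) = Valid G A h × (alive (run G A h) x ≡ true)

LocalityAware : ∀ {n} → Adj n → Healer n → Set
LocalityAware {n} G A =
  ∀ (h : List (Fin n)) (x : Fin n) → Valid G A h → alive (run G A h) x ≡ true →
  ∀ (u w : Fin n) → A h x u w ≡ true →
  (E (run G A h) x u ≡ true) × (E (run G A h) x w ≡ true) × (u ≢ w)

KeepsConnected : ∀ {n} → Adj n → Healer n → Set
KeepsConnected {n} G A = ∀ (h : List (Fin n)) → Valid G A h → Connected (run G A h)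

module Submission where

open import Defs
open import Data.Nat using (ℕ; _≤_; _+_)
open import Data.Nat.Logarithm using (⌈log₂_⌉)
open import Data.Fin using (Fin)
open import Data.List using (List)
open import Data.Product using (Σ; _×_; ∃)
open import Data.Bool using (true)
open import Relation.Binary.PropositionalEquality using (_≡_)

open import Data.Nat using (z≤n; s≤s)
open import Data.Nat.Properties using (≤-trans; <⇒≤; m≤n+m; +-monoʳ-≤)
open import Data.Product using (_,_)
open import Data.Sum using (_⊎_)
open import Relation.Binary.PropositionalEquality using (_≢_; trans)
open import Relation.Nullary using (¬_; Dec)

-- The network is the complete (t+1)-ary tree with t + 2 levels, where t = 6 + N; it has
-- n ≤ (t+1)^(t+2) nodes, so log log n ≤ t. The adversary works bottom-up. For a node c of
-- height e + 1 with untouched subtree, it first plays the subtrees of the t + 1 children of c,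
-- then deletes c. Unless some node has already gained t edges, each child's play ends either
-- sealed (the child's subtree meets the rest of the network only at c, and c has gained an
-- edge) or with a gateway (exactly one node r of the child's subtree is adjacent to c, and r
-- has gained e edges). If t children are sealed, c itself has gained t edges. Otherwise at
-- least two children have gateways; the adversary deletes the sealed subtrees and then c.
-- Locality and connectivity now force either two new edges at the parent of c, or a single one
-- to a gateway node w that also gains another edge, so that w is a gateway of c that has gained
-- e + 1 edges. At the root, of height t + 1, this produces a node that has gained t edges.

module Counting where

  open import Data.Nat using (ℕ; zero; suc; _+_; _≤_; z≤n; s≤s)
  open import Data.Nat.Properties using (≤-refl; ≤-trans; ≤-reflexive; +-mono-≤; +-suc; m≤n+m)
  open import Data.Bool using (Bool; true; false; _∧_; _∨_; not)
  open import Data.Bool.Properties using () renaming (_≟_ to _≟ᵇ_)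
  open import Data.Fin using (Fin; zero; suc)
  open import Data.Fin.Properties using (_≟_; suc-injective; any?)
  open import Data.List using (length; filterᵇ; allFin; tabulate)
  open import Data.Product using (Σ; _×_; _,_)
  open import Data.Sum using (_⊎_; inj₁; inj₂)
  open import Data.Empty using (⊥-elim)
  open import Function using (_∘_; id)
  open import Relation.Binary.PropositionalEquality
  open import Relation.Nullary using (¬_; yes; no; Dec; does)
  open import Relation.Nullary.Decidable using (⌊_⌋; _×-dec_; ¬?)

  true≢false : true ≢ false
  true≢false ()

  ∧-true⁻ : ∀ {a b} → a ∧ b ≡ true → a ≡ true × b ≡ true
  ∧-true⁻ {true} {true} _ = refl , refl

  ∧-true⁺ : ∀ {a b} → a ≡ true → b ≡ true → a ∧ b ≡ true
  ∧-true⁺ refl refl = refl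

  ∨-true⁻ : ∀ {a b} → a ∨ b ≡ true → a ≡ true ⊎ b ≡ true
  ∨-true⁻ {true}  _ = inj₁ refl
  ∨-true⁻ {false} p = inj₂ p

  ∨-trueˡ : ∀ {a} b → a ≡ true → a ∨ b ≡ true
  ∨-trueˡ b refl = refl

  ∨-trueʳ : ∀ a {b} → b ≡ true → a ∨ b ≡ true
  ∨-trueʳ true  _ = refl
  ∨-trueʳ false p = p

  true-iff : ∀ {a b} → (a ≡ true → b ≡ true) → (b ≡ true → a ≡ true) → a ≡ b
  true-iff {true}  {_}     to _    = sym (to refl)
  true-iff {false} {true}  _  from = from refl
  true-iff {false} {false} _  _    = refl

  does-true⁻ : ∀ {p} {P : Set p} (p? : Dec P) → does p? ≡ true → P
  does-true⁻ (yes p) _ = p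

  ≟-false⁻ : ∀ {n} {a b : Fin n} → not ⌊ a ≟ b ⌋ ≡ true → a ≢ b
  ≟-false⁻ {a = a} {b} e with a ≟ b
  ... | no a≢b = a≢b

  ≟-refl : ∀ {n} (a : Fin n) → ⌊ a ≟ a ⌋ ≡ true
  ≟-refl a with a ≟ a
  ... | yes _   = refl
  ... | no a≢a = ⊥-elim (a≢a refl)

  ≟-false⁺ : ∀ {n} {a b : Fin n} → a ≢ b → not ⌊ a ≟ b ⌋ ≡ true
  ≟-false⁺ {a = a} {b} a≢b with a ≟ b
  ... | yes a≡b = ⊥-elim (a≢b a≡b)
  ... | no _    = refl

  other-true? : ∀ {n} (P : Fin n → Bool) (v : Fin n) → Dec (Σ (Fin n) λ u → P u ≡ true × u ≢ v)
  other-true? P v = any? λ u → (P u ≟ᵇ true) ×-dec ¬? (u ≟ v)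

  only-true : ∀ {n} {P : Fin n → Bool} {v : Fin n} → ¬ (Σ (Fin n) λ u → P u ≡ true × u ≢ v) →
    ∀ u → P u ≡ true → u ≡ v
  only-true {v = v} none u Pu with u ≟ v
  ... | yes u≡v = u≡v
  ... | no u≢v  = ⊥-elim (none (u , Pu , u≢v))

  fromBool : Bool → ℕ
  fromBool true  = 1
  fromBool false = 0

  count : ∀ {n} → (Fin n → Bool) → ℕ
  count {zero}  P = 0
  count {suc n} P = fromBool (P zero) + count (P ∘ suc)

  length-filter-tabulate : ∀ {n} {A : Set} (f : Fin n → A) (P : A → Bool) →
    length (filterᵇ P (tabulate f)) ≡ count (P ∘ f)
  length-filter-tabulate {zero}  f P = refl
  length-filter-tabulate {suc n} f P with P (f zero)
  ... | true  = cong suc (length-filter-tabulate (f ∘ suc) P)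
  ... | false = length-filter-tabulate (f ∘ suc) P

  length-filter-allFin : ∀ {n} (P : Fin n → Bool) → length (filterᵇ P (allFin n)) ≡ count P
  length-filter-allFin = length-filter-tabulate id

  fromBool-mono : ∀ {a b} → (a ≡ true → b ≡ true) → fromBool a ≤ fromBool b
  fromBool-mono {false} _ = z≤n
  fromBool-mono {true}  h rewrite h refl = ≤-refl

  fromBool≤1 : ∀ a → fromBool a ≤ 1
  fromBool≤1 true  = ≤-refl
  fromBool≤1 false = z≤n

  count-cong : ∀ {n} {P Q : Fin n → Bool} → (∀ i → P i ≡ Q i) → count P ≡ count Q
  count-cong {zero}  _   = refl
  count-cong {suc n} P≗Q = cong₂ _+_ (cong fromBool (P≗Q zero)) (count-cong (P≗Q ∘ suc))

  count-mono : ∀ {n} {P Q : Fin n → Bool} → (∀ i → P i ≡ true → Q i ≡ true) → count P ≤ count Q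
  count-mono {zero}  _   = z≤n
  count-mono {suc n} P⊆Q = +-mono-≤ (fromBool-mono (P⊆Q zero)) (count-mono (P⊆Q ∘ suc))

  count-mono-except : ∀ {n} {P Q : Fin n → Bool} (v : Fin n) →
    (∀ i → i ≢ v → P i ≡ true → Q i ≡ true) → count P ≤ suc (count Q)
  count-mono-except {suc n} {P} {Q} zero P⊆Q =
    +-mono-≤ (fromBool≤1 (P zero))
      (≤-trans (count-mono (λ i → P⊆Q (suc i) λ ())) (m≤n+m _ (fromBool (Q zero))))
  count-mono-except {suc n} {P} {Q} (suc v) P⊆Q =
    ≤-trans (+-mono-≤ (fromBool-mono (P⊆Q zero λ ()))
                      (count-mono-except v (λ i i≢v → P⊆Q (suc i) (i≢v ∘ suc-injective))))
            (≤-reflexive (+-suc (fromBool (Q zero)) (count (Q ∘ suc))))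

  _∖_ : ∀ {n} → (Fin n → Bool) → Fin n → (Fin n → Bool)
  (Q ∖ w) i = not ⌊ i ≟ w ⌋ ∧ Q i

  ∖-true⁺ : ∀ {n} {Q : Fin n → Bool} {w i} → Q i ≡ true → i ≢ w → (Q ∖ w) i ≡ true
  ∖-true⁺ Qi i≢w = ∧-true⁺ (≟-false⁺ i≢w) Qi

  count-split : ∀ {n} {Q Q′ : Fin n → Bool} (w : Fin n) → Q w ≡ true → Q′ w ≡ false →
    (∀ i → i ≢ w → Q′ i ≡ Q i) → count Q ≡ suc (count Q′)
  count-split {suc n} {Q} {Q′} zero Qw Q′w Q′≗Q rewrite Qw | Q′w =
    cong suc (count-cong λ i → sym (Q′≗Q (suc i) λ ()))
  count-split {suc n} {Q} {Q′} (suc w) Qw Q′w Q′≗Q rewrite Q′≗Q zero (λ ()) =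
    trans (cong (fromBool (Q zero) +_) (count-split w Qw Q′w λ i i≢w → Q′≗Q (suc i) (i≢w ∘ suc-injective)))
          (+-suc (fromBool (Q zero)) _)

  count-remove : ∀ {n} (Q : Fin n → Bool) (w : Fin n) → Q w ≡ true → count Q ≡ suc (count (Q ∖ w))
  count-remove Q w Qw = count-split w Qw removed kept
    where
    removed : (Q ∖ w) w ≡ false
    removed rewrite ≟-refl w = refl
    kept : ∀ i → i ≢ w → (Q ∖ w) i ≡ Q i
    kept i i≢w rewrite ≟-false⁺ i≢w = refl

  count-gain : ∀ {n} {P Q : Fin n → Bool} (v w : Fin n) → (∀ i → i ≢ v → P i ≡ true → Q i ≡ true) →
    Q w ≡ true → P w ≡ false → count P ≤ count Q
  count-gain {P = P} {Q} v w P⊆Q Qw Pw =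
    ≤-trans (count-mono-except {Q = Q ∖ w} v λ i i≢v Pi →
               ∖-true⁺ {Q = Q} (P⊆Q i i≢v Pi) λ { refl → true≢false (trans (sym Pi) Pw) })
            (≤-reflexive (sym (count-remove Q w Qw)))

  count-gain₂ : ∀ {n} {P Q : Fin n → Bool} (v w₁ w₂ : Fin n) → (∀ i → i ≢ v → P i ≡ true → Q i ≡ true) →
    Q w₁ ≡ true → P w₁ ≡ false → Q w₂ ≡ true → P w₂ ≡ false → w₁ ≢ w₂ → suc (count P) ≤ count Q
  count-gain₂ {P = P} {Q} v w₁ w₂ P⊆Q Qw₁ Pw₁ Qw₂ Pw₂ w₁≢w₂ =
    ≤-trans (s≤s (count-mono-except {Q = (Q ∖ w₁) ∖ w₂} v λ i i≢v Pi →
               ∖-true⁺ {Q = Q ∖ w₁} (∖-true⁺ {Q = Q} (P⊆Q i i≢v Pi) (avoid Pw₁ Pi)) (avoid Pw₂ Pi)))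
      (≤-reflexive (sym (trans (count-remove Q w₁ Qw₁)
        (cong suc (count-remove (Q ∖ w₁) w₂ (∖-true⁺ {Q = Q} Qw₂ (w₁≢w₂ ∘ sym)))))))
    where
    avoid : ∀ {w i} → P w ≡ false → P i ≡ true → i ≢ w
    avoid Pw Pi refl = true≢false (trans (sym Pi) Pw)

module _ {n : ℕ} {s : Network n} where

  reach-trans : ∀ {a b c} → Reach s a b → Reach s b c → Reach s a c
  reach-trans here       r′ = r′
  reach-trans (step e r) r′ = step e (reach-trans r r′)

  reach-sym : (∀ a b → E s a b ≡ E s b a) → ∀ {a b} → Reach s a b → Reach s b a
  reach-sym E-sym here              = here
  reach-sym E-sym (step {u} {v} e r) = reach-trans (reach-sym E-sym r) (step (trans (E-sym v u) e) here)

  connected-via : (∀ a b → E s a b ≡ E s b a) → (r : Fin n) → (∀ u → Reach s u r) → Connected s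
  connected-via E-sym r to-r u v _ _ = reach-trans (to-r u) (reach-sym E-sym (to-r v))

record RootedTree {n : ℕ} (G : Adj n) : Set₁ where
  field
    root                : Fin n
    parent              : Fin n → Fin n
    Subtree             : Fin n → Fin n → Set
    subtree?            : ∀ c b → Dec (Subtree c b)
    subtree-refl        : ∀ c → Subtree c c
    subtree-parent      : ∀ {c b} → c ≢ root → Subtree c b → Subtree (parent c) b
    parent∉subtree      : ∀ {c} → c ≢ root → ¬ Subtree c (parent c)
    siblings-disjoint   : ∀ {c₁ c₂ b} → parent c₁ ≡ parent c₂ → c₁ ≢ root → c₂ ≢ root →
                          Subtree c₁ b → Subtree c₂ b → c₁ ≡ c₂
    parent-edge         : ∀ {c} → c ≢ root → G c (parent c) ≡ true
    subtree-exit        : ∀ {c a b} → c ≢ root → Subtree c a → G a b ≡ true → Subtree c b ⊎ b ≡ parent c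
    subtree-parent-edge : ∀ {c b} → c ≢ root → Subtree c b → G b (parent c) ≡ true → b ≡ c

module Branching {n : ℕ} {G : Adj n} (T : RootedTree G) (t : ℕ) where

  open import Data.Nat using (zero; suc)
  open import Data.List using (List; length)
  open import Data.List.Relation.Unary.All using (All; lookupAny)
  import Data.List.Relation.Unary.All as All
  open import Data.List.Relation.Unary.Any using (Any)
  open import Data.List.Relation.Unary.Unique.Propositional using (Unique)
  open import Data.Product using (_×_; _,_; uncurry)
  open import Relation.Binary.PropositionalEquality using (refl; trans; sym)

  open RootedTree T

  Child : Fin n → Fin n → Set
  Child c c′ = parent c′ ≡ c × c′ ≢ root

  InChildren : List (Fin n) → Fin n → Set
  InChildren cs b = Any (λ c′ → Subtree c′ b) cs

  data Complete : ℕ → Fin n → Set where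
    leaf : ∀ {c} → (∀ b → Subtree c b → b ≡ c) → Complete zero c
    node : ∀ {e c} (cs : List (Fin n)) → length cs ≡ suc t → Unique cs → All (Child c) cs →
           All (Complete e) cs → (∀ b → Subtree c b → b ≢ c → InChildren cs b) → Complete (suc e) c

  child-edge : ∀ {p c} → Child p c → G c p ≡ true
  child-edge (refl , c≢root) = parent-edge c≢root

  child-subtree : ∀ {c c′ b} → Child c c′ → Subtree c′ b → Subtree c b
  child-subtree (refl , c′≢root) = subtree-parent c′≢root

  child-subtree-≢ : ∀ {c c′ b} → Child c c′ → Subtree c′ b → b ≢ c
  child-subtree-≢ (refl , c′≢root) C′b refl = parent∉subtree c′≢root C′b

  siblings-apart : ∀ {c c₁ c₂ b} → Child c c₁ → Child c c₂ → c₁ ≢ c₂ → Subtree c₂ b → ¬ Subtree c₁ b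
  siblings-apart (p₁ , n₁) (p₂ , n₂) c₁≢c₂ C₂b C₁b = c₁≢c₂ (siblings-disjoint (trans p₁ (sym p₂)) n₁ n₂ C₁b C₂b)

  in-children-subtree : ∀ {c cs b} → All (Child c) cs → InChildren cs b → Subtree c b
  in-children-subtree chs i = uncurry child-subtree (lookupAny chs i)

  in-children-≢ : ∀ {c cs b} → All (Child c) cs → InChildren cs b → b ≢ c
  in-children-≢ chs i = uncurry child-subtree-≢ (lookupAny chs i)

  outside-sibling : ∀ {c c₁ cs b} → Child c c₁ → All (Child c) cs → All (c₁ ≢_) cs → InChildren cs b →
    ¬ Subtree c₁ b × b ≢ c
  outside-sibling ch₁ chs c₁∉cs i with lookupAny (All.zip (chs , c₁∉cs)) i
  ... | (ch , c₁≢c′) , C′b = siblings-apart ch₁ ch c₁≢c′ C′b , child-subtree-≢ ch C′b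

module Healing {n : ℕ} (G : Adj n) (G-sym : Symmetric G) (G-irrefl : Irreflexive G)
  (A : Healer n) (local : LocalityAware G A) where

  open import Data.Bool using (Bool; true; false; _∧_; _∨_)
  open import Data.Bool.Properties using (∧-assoc; ∧-comm; ∨-comm)
  open import Data.Nat using (suc; _≤_)
  open import Data.Fin using (Fin)
  open import Data.List using (List; []; _∷_)
  open import Data.Product using (_×_; _,_; proj₁; proj₂)
  open import Data.Sum using (_⊎_; inj₁; inj₂; [_,_]′)
  open import Data.Empty using (⊥-elim)
  open import Relation.Binary.PropositionalEquality
  open import Relation.Nullary using (¬_)
  open Counting

  net : List (Fin n) → Network n
  net = run G A

  adj-sym : ∀ h a b → adj (net h) a b ≡ adj (net h) b a
  adj-sym []      a b = G-sym a b
  adj-sym (x ∷ h) a b rewrite adj-sym h a b = cong (adj (net h) b a ∨_) (∨-comm (A h x a b) (A h x b a))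

  E-sym : ∀ h a b → E (net h) a b ≡ E (net h) b a
  E-sym h a b rewrite adj-sym h a b =
    trans (sym (∧-assoc (alive s a) (alive s b) _))
          (trans (cong (_∧ adj s b a) (∧-comm (alive s a) (alive s b))) (∧-assoc (alive s b) (alive s a) _))
    where s = net h

  E⁻ : ∀ {h a b} → E (net h) a b ≡ true →
    alive (net h) a ≡ true × alive (net h) b ≡ true × adj (net h) a b ≡ true
  E⁻ e with ∧-true⁻ e
  ... | a-alive , rest with ∧-true⁻ rest
  ... | b-alive , ab = a-alive , b-alive , ab

  E⁺ : ∀ {h a b} → alive (net h) a ≡ true → alive (net h) b ≡ true → adj (net h) a b ≡ true →
    E (net h) a b ≡ true
  E⁺ a-alive b-alive ab = ∧-true⁺ a-alive (∧-true⁺ b-alive ab)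

  adj-irrefl : ∀ {h} → Valid G A h → ∀ a → adj (net h) a a ≢ true
  adj-irrefl {[]}    _ a aa = true≢false (trans (sym aa) (G-irrefl a))
  adj-irrefl {x ∷ h} (valid , x-alive) a aa with ∨-true⁻ aa
  ... | inj₁ old = adj-irrefl valid a old
  ... | inj₂ new with ∨-true⁻ new
  ... | inj₁ added = proj₂ (proj₂ (local h x valid x-alive a a added)) refl
  ... | inj₂ added = proj₂ (proj₂ (local h x valid x-alive a a added)) refl

  E-irrefl : ∀ {h} → Valid G A h → ∀ a → E (net h) a a ≢ true
  E-irrefl {h} valid a e = adj-irrefl valid a (proj₂ (proj₂ (E⁻ {h} e)))

  Closed : Network n → (Fin n → Set) → Fin n → Set
  Closed s X y = ∀ a b → X a → E s a b ≡ true → X b ⊎ b ≡ y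

  AgreeOn : Network n → Network n → (Fin n → Set) → Set
  AgreeOn s s′ X = ∀ a → X a → (alive s′ a ≡ alive s a) × (∀ b → E s′ a b ≡ E s a b)

  agree-refl : ∀ {s X} → AgreeOn s s X
  agree-refl _ _ = refl , λ _ → refl

  agree-trans : ∀ {s₁ s₂ s₃ X} → AgreeOn s₁ s₂ X → AgreeOn s₂ s₃ X → AgreeOn s₁ s₃ X
  agree-trans g₁ g₂ a Xa = trans (proj₁ (g₂ a Xa)) (proj₁ (g₁ a Xa)) ,
    λ b → trans (proj₂ (g₂ a Xa) b) (proj₂ (g₁ a Xa) b)

  closed-agree : ∀ {s s′ X y} → AgreeOn s s′ X → Closed s X y → Closed s′ X y
  closed-agree g cl a b Xa e = cl a b Xa (trans (sym (proj₂ (g a Xa) b)) e)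

  reach-closed : ∀ {s} (P : Fin n → Set) → (∀ a b → P a → E s a b ≡ true → P b) →
    ∀ {a b} → Reach s a b → P a → P b
  reach-closed P cl here        Pa = Pa
  reach-closed P cl (step e r) Pa = reach-closed P cl r (cl _ _ Pa e)

  degree-count : ∀ s a → degree {n} s a ≡ count (E s a)
  degree-count s a = length-filter-allFin (E s a)

  degree-agree : ∀ {s s′ X a} → AgreeOn s s′ X → X a → degree s′ a ≡ degree s a
  degree-agree {s} {s′} {a = a} g Xa =
    trans (degree-count s′ a) (trans (count-cong (proj₂ (g a Xa))) (sym (degree-count s a)))

  module Deletion (h : List (Fin n)) (x : Fin n) where

    s s′ : Network n
    s  = net h
    s′ = net (x ∷ h)

    Added : Fin n → Fin n → Bool
    Added a b = A h x a b ∨ A h x b a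

    alive′⁻ : ∀ {a} → alive s′ a ≡ true → alive s a ≡ true × a ≢ x
    alive′⁻ e with ∧-true⁻ e
    ... | a-alive , a≢x = a-alive , ≟-false⁻ a≢x

    alive′⁺ : ∀ {a} → alive s a ≡ true → a ≢ x → alive s′ a ≡ true
    alive′⁺ a-alive a≢x = ∧-true⁺ a-alive (≟-false⁺ a≢x)

    alive′-dead : ∀ {a} → alive s a ≡ false → alive s′ a ≡ false
    alive′-dead e rewrite e = refl

    killed : alive s′ x ≡ false
    killed rewrite ≟-refl x with alive s x
    ... | true  = refl
    ... | false = refl

    E′⁻ : ∀ {a b} → E s′ a b ≡ true →
      (alive s a ≡ true × a ≢ x) × (alive s b ≡ true × b ≢ x) × (E s a b ≡ true ⊎ Added a b ≡ true)
    E′⁻ e with ∧-true⁻ e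
    ... | a-alive , rest with ∧-true⁻ rest
    ... | b-alive , ab with alive′⁻ a-alive | alive′⁻ b-alive
    ... | (a-alive′ , a≢x) | (b-alive′ , b≢x) with ∨-true⁻ ab
    ... | inj₁ old   = (a-alive′ , a≢x) , (b-alive′ , b≢x) , inj₁ (E⁺ {h} a-alive′ b-alive′ old)
    ... | inj₂ added = (a-alive′ , a≢x) , (b-alive′ , b≢x) , inj₂ added

    E′-old : ∀ {a b} → E s a b ≡ true → a ≢ x → b ≢ x → E s′ a b ≡ true
    E′-old e a≢x b≢x with E⁻ {h} e
    ... | a-alive , b-alive , ab =
      ∧-true⁺ (alive′⁺ a-alive a≢x) (∧-true⁺ (alive′⁺ b-alive b≢x) (∨-trueˡ _ ab))

    E′-added : ∀ {a b} → alive s a ≡ true → a ≢ x → alive s b ≡ true → b ≢ x → Added a b ≡ true →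
      E s′ a b ≡ true
    E′-added {a} {b} a-alive a≢x b-alive b≢x added =
      ∧-true⁺ (alive′⁺ a-alive a≢x) (∧-true⁺ (alive′⁺ b-alive b≢x) (∨-trueʳ (adj s a b) added))

    degree-gain : ∀ {a} w → a ≢ x → E s′ a w ≡ true → E s a w ≡ false → degree s a ≤ degree s′ a
    degree-gain {a} w a≢x new ¬old =
      subst₂ _≤_ (sym (degree-count s a)) (sym (degree-count s′ a))
        (count-gain x w (λ i i≢x e → E′-old e a≢x i≢x) new ¬old)

    degree-gain₂ : ∀ {a} w w′ → a ≢ x → E s′ a w ≡ true → E s a w ≡ false →
      E s′ a w′ ≡ true → E s a w′ ≡ false → w ≢ w′ → suc (degree s a) ≤ degree s′ a
    degree-gain₂ {a} w w′ a≢x new ¬old new′ ¬old′ w≢w′ =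
      subst₂ _≤_ (cong suc (sym (degree-count s a))) (sym (degree-count s′ a))
        (count-gain₂ x w w′ (λ i i≢x e → E′-old e a≢x i≢x) new ¬old new′ ¬old′ w≢w′)

    module Legal (valid : Valid G A h) (x-alive : alive s x ≡ true) where

      added-local : ∀ {a b} → Added a b ≡ true → E s x a ≡ true × E s x b ≡ true × a ≢ b
      added-local {a} {b} added with ∨-true⁻ added
      ... | inj₁ ab = local h x valid x-alive a b ab
      ... | inj₂ ba with local h x valid x-alive b a ba
      ... | xb , xa , b≢a = xa , xb , λ a≡b → b≢a (sym a≡b)

      neighbour⁻ : ∀ {a} → E s x a ≡ true → alive s a ≡ true × a ≢ x
      neighbour⁻ e = proj₁ (proj₂ (E⁻ {h} e)) , λ { refl → E-irrefl valid x e }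

      added-edge : ∀ {a b} → Added a b ≡ true → E s′ a b ≡ true
      added-edge added with added-local added
      ... | xa , xb , _ with neighbour⁻ xa | neighbour⁻ xb
      ... | a-alive , a≢x | b-alive , b≢x = E′-added a-alive a≢x b-alive b≢x added

      added-sym : ∀ a b → Added a b ≡ Added b a
      added-sym a b = ∨-comm (A h x a b) (A h x b a)

      unaffected : ∀ {a} → a ≢ x → E s x a ≢ true → (alive s′ a ≡ alive s a) × (∀ b → E s′ a b ≡ E s a b)
      unaffected {a} a≢x a∉N[x] = still-alive , λ b → true-iff (to b) (from b)
        where
        still-alive : alive s′ a ≡ alive s a
        still-alive rewrite ≟-false⁺ a≢x with alive s a
        ... | true  = refl
        ... | false = refl
        to : ∀ b → E s′ a b ≡ true → E s a b ≡ true
        to b e with E′⁻ e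
        ... | _ , _ , inj₁ old   = old
        ... | _ , _ , inj₂ added = ⊥-elim (a∉N[x] (proj₁ (added-local added)))
        from : ∀ b → E s a b ≡ true → E s′ a b ≡ true
        from b e = E′-old e a≢x λ { refl → a∉N[x] (trans (E-sym h x a) e) }

      closed-step : ∀ {X y} → Closed s X y → x ≢ y → Closed s′ X y
      closed-step {X} {y} cl x≢y a b Xa e with E′⁻ e
      ... | _ , _ , inj₁ old = cl a b Xa old
      ... | _ , _ , inj₂ added with added-local added
      ... | xa , xb , _ with cl a x Xa (trans (E-sym h a x) xa)
      ... | inj₁ Xx  = cl x b Xx xb
      ... | inj₂ x≡y = ⊥-elim (x≢y x≡y)

      agree-avoiding-step : ∀ {Y y} → Closed s Y y → ¬ Y x → x ≢ y → AgreeOn s s′ Y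
      agree-avoiding-step {Y} {y} cl ¬Yx x≢y a Ya =
        unaffected (λ { refl → ¬Yx Ya }) λ e → [ ¬Yx , x≢y ]′ (cl a x Ya (trans (E-sym h a x) e))

  data Continues (P : Fin n → Set) (h : List (Fin n)) : List (Fin n) → Set where
    stop : Continues P h h
    del  : ∀ {x h′} → P x → Continues P h h′ → Continues P h (x ∷ h′)

  continues-trans : ∀ {P h₁ h₂ h₃} → Continues P h₁ h₂ → Continues P h₂ h₃ → Continues P h₁ h₃
  continues-trans c₁ stop        = c₁
  continues-trans c₁ (del Px c₂) = del Px (continues-trans c₁ c₂)

  continues-map : ∀ {P Q h h′} → (∀ {x} → P x → Q x) → Continues P h h′ → Continues Q h h′
  continues-map f stop         = stop
  continues-map f (del Px c) = del (f Px) (continues-map f c)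

  alive-continues : ∀ {a h h′} → Continues (λ x → x ≢ a) h h′ → Valid G A h′ →
    alive (net h) a ≡ true → alive (net h′) a ≡ true
  alive-continues stop _ e = e
  alive-continues {h′ = x ∷ h′} (del x≢a c) (valid , _) e =
    Deletion.alive′⁺ h′ x (alive-continues c valid e) λ a≡x → x≢a (sym a≡x)

  dead-continues : ∀ {P a h h′} → Continues P h h′ → Valid G A h′ →
    alive (net h) a ≡ false → alive (net h′) a ≡ false
  dead-continues stop _ e = e
  dead-continues {h′ = x ∷ h′} (del _ c) (valid , _) e = Deletion.alive′-dead h′ x (dead-continues c valid e)

  closed-continues : ∀ {h h′ X y} → Continues (λ x → x ≢ y) h h′ → Valid G A h′ →
    Closed (net h) X y → Closed (net h′) X y
  closed-continues stop _ cl = cl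
  closed-continues {h′ = x ∷ h′} (del x≢y c) (valid , x-alive) cl =
    Deletion.Legal.closed-step h′ x valid x-alive (closed-continues c valid cl) x≢y

  agree-avoiding : ∀ {h h′ Y y} → Continues (λ x → ¬ Y x × x ≢ y) h h′ → Valid G A h′ →
    Closed (net h) Y y → AgreeOn (net h) (net h′) Y
  agree-avoiding stop _ _ = agree-refl
  agree-avoiding (del (¬Yx , x≢y) c) (valid , x-alive) cl =
    agree-trans (agree-avoiding c valid cl)
      (Deletion.Legal.agree-avoiding-step _ _ valid x-alive
        (closed-continues (continues-map proj₂ c) valid cl) ¬Yx x≢y)

module Adversary {n : ℕ} (G : Adj n) (G-sym : Symmetric G) (G-irrefl : Irreflexive G)
  (A : Healer n) (local : LocalityAware G A) (connected : KeepsConnected G A)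
  (t : ℕ) (T : RootedTree G) where

  open import Data.Nat using (zero; suc; _≤_; _+_; z≤n; s≤s)
  open import Data.Nat.Properties
    using (≤-refl; ≤-trans; ≤-reflexive; +-suc; +-identityʳ; +-comm; +-cancelˡ-≤; +-monoʳ-≤; ≰⇒>; _≤?_; module ≤-Reasoning)
  open import Data.Bool using (true; false)
  open import Data.Bool.Properties using (¬-not) renaming (_≟_ to _≟ᵇ_)
  open import Data.Fin.Properties using (_≟_; any?)
  open import Data.Fin using (Fin)
  open import Data.List using (List; []; _∷_; length; allFin)
  open import Data.List.Relation.Unary.All using (All; []; _∷_; lookupAny)
  import Data.List.Relation.Unary.All as All
  open import Data.List.Relation.Unary.Any using (here; there)
  open import Data.List.Relation.Unary.Unique.Propositional using (Unique; []; _∷_)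
  open import Data.List.Membership.Propositional using (_∈_)
  open import Data.List.Membership.Propositional.Properties using (∈-allFin)
  open import Data.Product using (Σ; _×_; _,_; proj₁; proj₂)
  open import Data.Sum using (_⊎_; inj₁; inj₂)
  open import Data.Empty using (⊥; ⊥-elim)
  open import Relation.Binary.PropositionalEquality
  open import Relation.Nullary using (¬_; yes; no)
  open Counting
  open Healing G G-sym G-irrefl A local
  open RootedTree T
  open Branching T t
  open ≤-Reasoning hiding (stop)

  Untouched : Network n → Fin n → Set
  Untouched s c = ∀ a → Subtree c a → alive s a ≡ true × (∀ b → E s a b ≡ G a b)

  Dead : Network n → Fin n → Set
  Dead s c = ∀ a → Subtree c a → alive s a ≡ false

  Win : Network n → Set
  Win s = Σ (Fin n) λ v → alive s v ≡ true × degreeG G v + t ≤ degree s v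

  -- The subtree of c is attached to the rest of the network only through the edge y ― r,
  -- and r has gained e edges.
  record Gateway (s : Network n) (c y : Fin n) (e : ℕ) (r : Fin n) : Set where
    field
      closed : Closed s (Subtree c) y
      inside : Subtree c r
      edge   : E s y r ≡ true
      unique : ∀ b → Subtree c b → E s y b ≡ true → b ≡ r
      gain   : degreeG G r + e ≤ degree s r

  record Strategy (P : Fin n → Set) (h : List (Fin n)) (Goal : List (Fin n) → Set) : Set where
    constructor play
    field
      {end} : List (Fin n)
      moves : Continues P h end
      valid : Valid G A end
      goal  : Goal end

  data Outcome (e : ℕ) (c p : Fin n) (h h′ : List (Fin n)) : Set where
    win     : Win (net h′) → Outcome e c p h h′
    gateway : ∀ r → Gateway (net h′) c p e r → degree (net h) p ≤ degree (net h′) p → Outcome e c p h h′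
    sealed  : Closed (net h′) (Subtree c) p → suc (degree (net h) p) ≤ degree (net h′) p → Outcome e c p h h′

  gateway-agree : ∀ {h h′ c y e r} → AgreeOn (net h) (net h′) (Subtree c) →
    Gateway (net h) c y e r → Gateway (net h′) c y e r
  gateway-agree {h} {h′} {y = y} {r = r} g γ = record
    { closed = closed-agree g closed
    ; inside = inside
    ; edge   = trans (E-sym h′ y r) (trans (proj₂ (g r inside) y) (trans (E-sym h r y) edge))
    ; unique = λ b Cb e → unique b Cb (trans (E-sym h y b) (trans (sym (proj₂ (g b Cb) y)) (trans (E-sym h′ b y) e)))
    ; gain   = ≤-trans gain (≤-reflexive (sym (degree-agree g inside)))
    }
    where open Gateway γ

  untouched-agree : ∀ {s s′ c} → AgreeOn s s′ (Subtree c) → Untouched s c → Untouched s′ c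
  untouched-agree g u a Ca = trans (proj₁ (g a Ca)) (proj₁ (u a Ca)) ,
    λ b → trans (proj₂ (g a Ca) b) (proj₂ (u a Ca) b)

  untouched-closed : ∀ {s p c} → Child p c → Untouched s c → Closed s (Subtree c) p
  untouched-closed (refl , c≢root) u a b Ca e = subtree-exit c≢root Ca (trans (sym (proj₂ (u a Ca) b)) e)

  untouched-degree : ∀ {s c} → Untouched s c → degree s c ≡ degreeG G c
  untouched-degree {s} {c} u =
    trans (degree-count s c) (trans (count-cong (proj₂ (u c (subtree-refl c)))) (sym (length-filter-allFin (G c))))

  kill-among : ∀ c (l : List (Fin n)) h → Valid G A h →
    Strategy (Subtree c) h λ h′ → ∀ a → a ∈ l → Subtree c a → alive (net h′) a ≡ false
  kill-among c [] h valid = play stop valid λ _ ()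
  kill-among c (y ∷ l) h valid with subtree? c y | alive (net h) y in y-alive
  ... | no ¬Cy | _ with kill-among c l h valid
  ... | play moves valid′ dead = play moves valid′ λ
    { a (here refl) Ca → ⊥-elim (¬Cy Ca)
    ; a (there a∈l) Ca → dead a a∈l Ca }
  kill-among c (y ∷ l) h valid | yes Cy | false with kill-among c l h valid
  ... | play moves valid′ dead = play moves valid′ λ
    { a (here refl) _  → dead-continues moves valid′ y-alive
    ; a (there a∈l) Ca → dead a a∈l Ca }
  kill-among c (y ∷ l) h valid | yes Cy | true with kill-among c l (y ∷ h) (valid , y-alive)
  ... | play moves valid′ dead = play (continues-trans (del Cy stop) moves) valid′ λ
    { a (here refl) _  → dead-continues moves valid′ (Deletion.killed h y)
    ; a (there a∈l) Ca → dead a a∈l Ca }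

  kill : ∀ c h → Valid G A h → Strategy (Subtree c) h λ h′ → Dead (net h′) c
  kill c h valid with kill-among c (allFin n) h valid
  ... | play moves valid′ dead = play moves valid′ λ a Ca → dead a (∈-allFin a) Ca

  agree-sibling : ∀ {c c₁ cs h h′} → Child c c₁ → All (Child c) cs → All (c₁ ≢_) cs →
    Continues (InChildren cs) h h′ → Valid G A h′ → Closed (net h) (Subtree c₁) c →
    AgreeOn (net h) (net h′) (Subtree c₁)
  agree-sibling ch₁ chs c₁∉cs moves = agree-avoiding (continues-map (outside-sibling ch₁ chs c₁∉cs) moves)

  dead-closed : ∀ {s c y} → Dead s c → Closed s (Subtree c) y
  dead-closed dead a b Ca e = ⊥-elim (true≢false (trans (sym (proj₁ (∧-true⁻ e))) (dead a Ca)))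

  dead-agree : ∀ {s s′ c} → AgreeOn s s′ (Subtree c) → Dead s c → Dead s′ c
  dead-agree g dead a Ca = trans (proj₁ (g a Ca)) (dead a Ca)

  #inj₁ #inj₂ : ∀ {P Q : Fin n → Set} {cs} → All (λ c → P c ⊎ Q c) cs → ℕ
  #inj₁ []            = 0
  #inj₁ (inj₁ _ ∷ st) = suc (#inj₁ st)
  #inj₁ (inj₂ _ ∷ st) = #inj₁ st
  #inj₂ []            = 0
  #inj₂ (inj₁ _ ∷ st) = #inj₂ st
  #inj₂ (inj₂ _ ∷ st) = suc (#inj₂ st)

  #inj₂+#inj₁ : ∀ {P Q : Fin n → Set} {cs} (st : All (λ c → P c ⊎ Q c) cs) → #inj₂ st + #inj₁ st ≡ length cs
  #inj₂+#inj₁ []            = refl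
  #inj₂+#inj₁ (inj₁ _ ∷ st) = trans (+-suc (#inj₂ st) (#inj₁ st)) (cong suc (#inj₂+#inj₁ st))
  #inj₂+#inj₁ (inj₂ _ ∷ st) = cong suc (#inj₂+#inj₁ st)

  some-inj₁ : ∀ {P Q : Fin n → Set} {cs} (st : All (λ c → P c ⊎ Q c) cs) → 1 ≤ #inj₁ st → Σ (Fin n) P
  some-inj₁ (inj₁ p ∷ _)  _  = _ , p
  some-inj₁ (inj₂ _ ∷ st) le = some-inj₁ st le

  two-inj₁ : ∀ {P Q : Fin n → Set} {cs} (st : All (λ c → P c ⊎ Q c) cs) → length cs ≡ suc t →
    ¬ t ≤ #inj₂ st → 2 ≤ #inj₁ st
  two-inj₁ st len t≰ = +-cancelˡ-≤ (#inj₂ st) 2 (#inj₁ st) (begin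
    #inj₂ st + 2         ≡⟨ +-comm (#inj₂ st) 2 ⟩
    suc (suc (#inj₂ st)) ≤⟨ s≤s (≰⇒> t≰) ⟩
    suc t                ≡⟨ sym (trans (#inj₂+#inj₁ st) len) ⟩
    #inj₂ st + #inj₁ st  ∎)

  Status : ℕ → Fin n → (Network n → Fin n → Set) → Network n → Fin n → Set
  Status e c Q s c′ = (Σ (Fin n) λ r → Gateway s c′ c e r) ⊎ Q s c′

  Played Pruned : ℕ → Fin n → Network n → Fin n → Set
  Played e c = Status e c λ s c′ → Closed s (Subtree c′) c
  Pruned e c = Status e c Dead

  module _ {e : ℕ} {c : Fin n} {Q : Network n → Fin n → Set}
    (Q-closed : ∀ {s c′} → Q s c′ → Closed s (Subtree c′) c)
    (Q-agree : ∀ {s s′ c′} → AgreeOn s s′ (Subtree c′) → Q s c′ → Q s′ c′) where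

    status-agree : ∀ {h h′ c′} → AgreeOn (net h) (net h′) (Subtree c′) →
      Status e c Q (net h) c′ → Status e c Q (net h′) c′
    status-agree {h} {h′} g (inj₁ (r , γ)) = inj₁ (r , gateway-agree {h} {h′} g γ)
    status-agree         g (inj₂ q)       = inj₂ (Q-agree g q)

    status-closed : ∀ {s c′} → Status e c Q s c′ → Closed s (Subtree c′) c
    status-closed (inj₁ (_ , γ)) = Gateway.closed γ
    status-closed (inj₂ q)       = Q-closed q

    status-continue : ∀ {c₁ c′ h h′} → Child c c₁ → Child c c′ → c₁ ≢ c′ →
      Continues (Subtree c₁) h h′ → Valid G A h′ → Status e c Q (net h) c′ → Status e c Q (net h′) c′
    status-continue {h = h} {h′} ch₁ ch′ c₁≢c′ moves valid σ =
      status-agree {h} {h′} (agree-sibling ch′ (ch₁ ∷ []) ((λ c′≡c₁ → c₁≢c′ (sym c′≡c₁)) ∷ [])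
                     (continues-map here moves) valid (status-closed σ)) σ

    statuses-continue : ∀ {c₁ cs h h′} → Child c c₁ → All (c₁ ≢_) cs → All (Child c) cs →
      Continues (Subtree c₁) h h′ → Valid G A h′ → (st : All (Status e c Q (net h)) cs) →
      Σ (All (Status e c Q (net h′)) cs) λ st′ → #inj₁ st′ ≡ #inj₁ st × #inj₂ st′ ≡ #inj₂ st
    statuses-continue ch₁ [] [] moves valid [] = [] , refl , refl
    statuses-continue ch₁ (c₁≢c′ ∷ c₁∉cs) (ch′ ∷ chs) moves valid (inj₁ γ ∷ st)
      with statuses-continue ch₁ c₁∉cs chs moves valid st
    ... | st′ , same₁ , same₂ =
      status-continue ch₁ ch′ c₁≢c′ moves valid (inj₁ γ) ∷ st′ , cong suc same₁ , same₂
    statuses-continue ch₁ (c₁≢c′ ∷ c₁∉cs) (ch′ ∷ chs) moves valid (inj₂ q ∷ st)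
      with statuses-continue ch₁ c₁∉cs chs moves valid st
    ... | st′ , same₁ , same₂ =
      status-continue ch₁ ch′ c₁≢c′ moves valid (inj₂ q) ∷ st′ , same₁ , cong suc same₂

  played-continue : ∀ {e c c₁ cs h h′} → Child c c₁ → All (c₁ ≢_) cs → All (Child c) cs →
    Continues (Subtree c₁) h h′ → Valid G A h′ → (st : All (Played e c (net h)) cs) →
    Σ (All (Played e c (net h′)) cs) λ st′ → #inj₁ st′ ≡ #inj₁ st × #inj₂ st′ ≡ #inj₂ st
  played-continue {c = c} = statuses-continue {Q = λ s c′ → Closed s (Subtree c′) c} (λ cl → cl) closed-agree

  pruned-continue : ∀ {e c c₁ cs h h′} → Child c c₁ → All (c₁ ≢_) cs → All (Child c) cs →
    Continues (Subtree c₁) h h′ → Valid G A h′ → (st : All (Pruned e c (net h)) cs) →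
    Σ (All (Pruned e c (net h′)) cs) λ st′ → #inj₁ st′ ≡ #inj₁ st × #inj₂ st′ ≡ #inj₂ st
  pruned-continue = statuses-continue dead-closed dead-agree

  prune : ∀ {e c} cs → Unique cs → All (Child c) cs → ∀ h → Valid G A h → (st : All (Played e c (net h)) cs) →
    Strategy (InChildren cs) h λ h′ → Σ (All (Pruned e c (net h′)) cs) λ st′ → #inj₁ st′ ≡ #inj₁ st
  prune [] [] [] h valid [] = play stop valid ([] , refl)
  prune (c₁ ∷ cs) (c₁∉cs ∷ uniq) (ch₁ ∷ chs) h valid (inj₁ (r , γ) ∷ st) with prune cs uniq chs h valid st
  ... | play {h₁} moves₁ valid₁ (st₁ , same₁) =
    play (continues-map there moves₁) valid₁
      (inj₁ (r , gateway-agree {h} {h₁} (agree-sibling ch₁ chs c₁∉cs moves₁ valid₁ (Gateway.closed γ)) γ) ∷ st₁ ,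
       cong suc same₁)
  prune (c₁ ∷ cs) (c₁∉cs ∷ uniq) (ch₁ ∷ chs) h valid (inj₂ _ ∷ st) with prune cs uniq chs h valid st
  ... | play {h₁} moves₁ valid₁ (st₁ , same₁) with kill c₁ h₁ valid₁
  ... | play moves₂ valid₂ dead with pruned-continue ch₁ c₁∉cs chs moves₂ valid₂ st₁
  ... | st₂ , same₂ , _ =
    play (continues-trans (continues-map there moves₁) (continues-map here moves₂)) valid₂
      (inj₂ dead ∷ st₂ , trans same₂ same₁)

  ChildStrategy : ℕ → Fin n → Set
  ChildStrategy e c = ∀ c′ → Child c c′ → Complete e c′ → ∀ h → Valid G A h → Untouched (net h) c′ →
    alive (net h) c ≡ true → Strategy (Subtree c′) h (Outcome e c′ c h)

  play-children : ∀ {e c} → ChildStrategy e c → ∀ cs → Unique cs → All (Child c) cs → All (Complete e) cs →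
    ∀ h → Valid G A h → All (Untouched (net h)) cs → alive (net h) c ≡ true →
    Strategy (InChildren cs) h λ h′ →
      Win (net h′) ⊎ Σ (All (Played e c (net h′)) cs) λ st → degree (net h) c + #inj₂ st ≤ degree (net h′) c
  play-children rec [] [] [] [] h valid [] _ = play stop valid (inj₂ ([] , ≤-reflexive (+-identityʳ _)))
  play-children {c = c} rec (c₁ ∷ cs) (c₁∉cs ∷ uniq) (ch₁ ∷ chs) (comp₁ ∷ comps) h valid (u₁ ∷ us) c-alive
    with play-children rec cs uniq chs comps h valid us c-alive
  ... | play moves₁ valid₁ (inj₁ w) = play (continues-map there moves₁) valid₁ (inj₁ w)
  ... | play {h₁} moves₁ valid₁ (inj₂ (st₁ , dg₁))
    with rec c₁ ch₁ comp₁ h₁ valid₁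
           (untouched-agree (agree-sibling ch₁ chs c₁∉cs moves₁ valid₁ (untouched-closed ch₁ u₁)) u₁)
           (alive-continues (continues-map (in-children-≢ chs) moves₁) valid₁ c-alive)
  ... | play {h₂} moves₂ valid₂ outcome with played-continue ch₁ c₁∉cs chs moves₂ valid₂ st₁ | outcome
  ... | _ | win w =
    play (continues-trans (continues-map there moves₁) (continues-map here moves₂)) valid₂ (inj₁ w)
  ... | st₂ , _ , same₂ | gateway r γ dg =
    play (continues-trans (continues-map there moves₁) (continues-map here moves₂)) valid₂
      (inj₂ (inj₁ (r , γ) ∷ st₂ , (begin
        degree (net h) c + #inj₂ st₂ ≡⟨ cong (degree (net h) c +_) same₂ ⟩
        degree (net h) c + #inj₂ st₁ ≤⟨ dg₁ ⟩
        degree (net h₁) c            ≤⟨ dg ⟩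
        degree (net h₂) c            ∎)))
  ... | st₂ , _ , same₂ | sealed cl dg =
    play (continues-trans (continues-map there moves₁) (continues-map here moves₂)) valid₂
      (inj₂ (inj₂ cl ∷ st₂ , (begin
        degree (net h) c + suc (#inj₂ st₂) ≡⟨ +-suc (degree (net h) c) (#inj₂ st₂) ⟩
        suc (degree (net h) c + #inj₂ st₂) ≡⟨ cong (λ k → suc (degree (net h) c + k)) same₂ ⟩
        suc (degree (net h) c + #inj₂ st₁) ≤⟨ s≤s dg₁ ⟩
        suc (degree (net h₁) c)            ≤⟨ dg ⟩
        degree (net h₂) c                  ∎)))

  GatewayAvoiding : ℕ → Fin n → Network n → Fin n → Set
  GatewayAvoiding e c s x = Σ (Fin n) λ c′ → Σ (Fin n) λ r → c′ ≢ x × Child c c′ × Gateway s c′ c e r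

  gateway-avoiding : ∀ {e c s cs} x → All (x ≢_) cs → All (Child c) cs →
    (st : All (Pruned e c s) cs) → 1 ≤ #inj₁ st → GatewayAvoiding e c s x
  gateway-avoiding x (x≢c′ ∷ _) (ch ∷ _) (inj₁ (r , γ) ∷ _) _ = _ , r , (λ c′≡x → x≢c′ (sym c′≡x)) , ch , γ
  gateway-avoiding x (_ ∷ x∉cs) (_ ∷ chs) (inj₂ _ ∷ st) le = gateway-avoiding x x∉cs chs st le

  gateways-avoiding : ∀ {e c s cs} → Unique cs → All (Child c) cs →
    (st : All (Pruned e c s) cs) → 2 ≤ #inj₁ st →
    ∀ x → GatewayAvoiding e c s x
  gateways-avoiding {cs = c₁ ∷ _} (c₁∉cs ∷ _) (ch ∷ chs) (inj₁ (r , γ) ∷ st) (s≤s le) x with c₁ ≟ x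
  ... | yes refl = gateway-avoiding c₁ c₁∉cs chs st le
  ... | no c₁≢x  = c₁ , r , c₁≢x , ch , γ
  gateways-avoiding (_ ∷ uniq) (_ ∷ chs) (inj₂ _ ∷ st) le x = gateways-avoiding uniq chs st le x

  -- Connectivity forces a new edge at q. Two new edges at q seal the subtree of c. If q ― w is the
  -- only one, w must also receive a new edge other than q, or the subtree of another gateway child
  -- would be cut off from q.
  module LastDeletion (e : ℕ) (c : Fin n) (cs : List (Fin n)) (h : List (Fin n)) (c≢root : c ≢ root)
    (valid : Valid G A h) (c-alive : alive (net h) c ≡ true) (q-alive : alive (net h) (parent c) ≡ true)
    (closed : Closed (net h) (Subtree c) (parent c)) (cover : ∀ b → Subtree c b → b ≢ c → InChildren cs b)
    (chs : All (Child c) cs) (st : All (Pruned e c (net h)) cs) (others : ∀ x → GatewayAvoiding e c (net h) x)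
    where

    open Deletion h c
    open Legal valid c-alive

    q : Fin n
    q = parent c

    q∉subtree : ¬ Subtree c q
    q∉subtree = parent∉subtree c≢root

    q≢c : q ≢ c
    q≢c q≡c = q∉subtree (subst (Subtree c) (sym q≡c) (subtree-refl c))

    c≢q : c ≢ q
    c≢q c≡q = q≢c (sym c≡q)

    owner : ∀ {b} → Subtree c b → b ≢ c → alive s b ≡ true →
      Σ (Fin n) λ c′ → Σ (Fin n) λ r → Child c c′ × Gateway s c′ c e r × Subtree c′ b
    owner {b} Cb b≢c b-alive with lookupAny (All.zip (chs , st)) (cover b Cb b≢c)
    ... | (ch , inj₁ (r , γ)) , C′b = _ , r , ch , γ , C′b
    ... | (ch , inj₂ dead)    , C′b = ⊥-elim (true≢false (trans (sym b-alive) (dead b C′b)))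

    neighbours : ∀ {b} → E s c b ≡ true →
      b ≡ q ⊎ Σ (Fin n) λ c′ → Σ (Fin n) λ r → Child c c′ × Gateway s c′ c e r × b ≡ r
    neighbours {b} cb with closed c b (subtree-refl c) cb
    ... | inj₂ b≡q = inj₁ b≡q
    ... | inj₁ Cb with owner Cb (proj₂ (neighbour⁻ cb)) (proj₁ (neighbour⁻ cb))
    ... | c′ , r , ch , γ , C′b = inj₂ (c′ , r , ch , γ , Gateway.unique γ b C′b cb)

    no-entry : ∀ {a b} → ¬ Subtree c a → Subtree c b → b ≢ c → E s a b ≢ true
    no-entry {a} {b} ¬Ca Cb b≢c ab with owner Cb b≢c (proj₁ (proj₂ (E⁻ {h} ab)))
    ... | c′ , r , ch , γ , C′b with Gateway.closed γ b a C′b (trans (E-sym h b a) ab)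
    ... | inj₁ C′a = ¬Ca (child-subtree ch C′a)
    ... | inj₂ refl = ¬Ca (subtree-refl c)

    rep-in-subtree : ∀ {c′ r} → Child c c′ → Gateway s c′ c e r → Subtree c r
    rep-in-subtree ch γ = child-subtree ch (Gateway.inside γ)

    q-not-next-to-rep : ∀ {c′ r} → Child c c′ → Gateway s c′ c e r → E s q r ≢ true
    q-not-next-to-rep {r = r} ch γ qr with Gateway.closed γ r q (Gateway.inside γ) (trans (E-sym h r q) qr)
    ... | inj₁ C′q = q∉subtree (child-subtree ch C′q)
    ... | inj₂ q≡c = q≢c q≡c

    reaches-every-rep : (P : Fin n → Set) → (∀ a b → P a → E s′ a b ≡ true → P b) → P q →
      ∀ {c′ r} → Gateway s c′ c e r → P r
    reaches-every-rep P P-closed Pq γ with neighbour⁻ (Gateway.edge γ)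
    ... | r-alive , r≢c =
      reach-closed P P-closed
        (connected (c ∷ h) (valid , c-alive) q _ (alive′⁺ q-alive q≢c) (alive′⁺ r-alive r≢c)) Pq

    not-old-at-q : ∀ {w} → Added q w ≡ true → E s q w ≡ false
    not-old-at-q q-w = ¬-not λ qw → not-old (neighbours (proj₁ (proj₂ (added-local q-w)))) qw
      where
      not-old : ∀ {w} → (w ≡ q ⊎ Σ (Fin n) λ c′ → Σ (Fin n) λ r → Child c c′ × Gateway s c′ c e r × w ≡ r) →
        E s q w ≢ true
      not-old (inj₁ refl) qq = E-irrefl valid q qq
      not-old (inj₂ (_ , _ , ch , γ , refl)) = q-not-next-to-rep ch γ

    isolated : (∀ w → Added q w ≢ true) → ∀ a b → ¬ Subtree c a → E s′ a b ≡ true → ¬ Subtree c b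
    isolated none a b ¬Ca ab with E′⁻ ab
    ... | _ , (_ , b≢c) , inj₁ old = λ Cb → no-entry ¬Ca Cb b≢c old
    ... | _ , _ , inj₂ added with neighbours (proj₁ (added-local added))
    ... | inj₁ refl = ⊥-elim (none b added)
    ... | inj₂ (_ , _ , ch , γ , refl) = ⊥-elim (¬Ca (rep-in-subtree ch γ))

    q-gains-edge : Σ (Fin n) λ w → Added q w ≡ true
    q-gains-edge with any? (λ w → Added q w ≟ᵇ true)
    ... | yes found = found
    ... | no none with others c
    ... | _ , _ , _ , ch , γ =
      ⊥-elim (reaches-every-rep (λ a → ¬ Subtree c a) (isolated λ w q-w → none (w , q-w)) q∉subtree γ
                (rep-in-subtree ch γ))

    sealed-if-two : ∀ {w w′} → Added q w ≡ true → Added q w′ ≡ true → w ≢ w′ → Outcome (suc e) c q h (c ∷ h)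
    sealed-if-two {w} {w′} q-w q-w′ w≢w′ =
      sealed (closed-step closed c≢q)
        (degree-gain₂ w w′ q≢c (added-edge q-w) (not-old-at-q q-w) (added-edge q-w′) (not-old-at-q q-w′) w≢w′)

    module OneNewEdge {w} (q-w : Added q w ≡ true) (only-w : ∀ u → Added q u ≡ true → u ≡ w)
      {cᵢ} (chᵢ : Child c cᵢ) (γᵢ : Gateway s cᵢ c e w) where

      w≢c : w ≢ c
      w≢c = proj₂ (neighbour⁻ (Gateway.edge γᵢ))

      w-not-next-to-q : E s w q ≡ false
      w-not-next-to-q = ¬-not λ wq → case (Gateway.closed γᵢ w q (Gateway.inside γᵢ) wq)
        where
        case : Subtree cᵢ q ⊎ q ≡ c → ⊥
        case (inj₁ Cᵢq) = q∉subtree (child-subtree chᵢ Cᵢq)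
        case (inj₂ q≡c) = q≢c q≡c

      extra-not-old : ∀ {u} → Added w u ≡ true → E s w u ≡ false
      extra-not-old {u} w-u = ¬-not λ wu → case (Gateway.closed γᵢ w u (Gateway.inside γᵢ) wu)
        where
        case : Subtree cᵢ u ⊎ u ≡ c → ⊥
        case (inj₁ Cᵢu) with added-local w-u
        ... | _ , cu , w≢u = w≢u (sym (Gateway.unique γᵢ u Cᵢu cu))
        case (inj₂ u≡c) = proj₂ (neighbour⁻ (proj₁ (proj₂ (added-local w-u)))) u≡c

      gateway-if-extra : ∀ {u} → Added w u ≡ true → u ≢ q → Outcome (suc e) c q h (c ∷ h)
      gateway-if-extra {u} w-u u≢q = gateway w γ (degree-gain w q≢c (added-edge q-w) (not-old-at-q q-w))
        where
        γ : Gateway s′ c q (suc e) w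
        γ = record
          { closed = closed-step closed c≢q
          ; inside = rep-in-subtree chᵢ γᵢ
          ; edge   = added-edge q-w
          ; unique = λ b Cb qb → unique-in b Cb (E′⁻ qb)
          ; gain   = begin
              degreeG G w + suc e   ≡⟨ +-suc (degreeG G w) e ⟩
              suc (degreeG G w + e) ≤⟨ s≤s (Gateway.gain γᵢ) ⟩
              suc (degree s w)      ≤⟨ degree-gain₂ q u w≢c (added-edge (trans (added-sym w q) q-w)) w-not-next-to-q
                                         (added-edge w-u) (extra-not-old w-u) (λ q≡u → u≢q (sym q≡u)) ⟩
              degree s′ w           ∎
          }
          where
          unique-in : ∀ b → Subtree c b →
            (alive s q ≡ true × q ≢ c) × (alive s b ≡ true × b ≢ c) × (E s q b ≡ true ⊎ Added q b ≡ true) → b ≡ w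
          unique-in b Cb (_ , (_ , b≢c) , inj₁ old) = ⊥-elim (no-entry q∉subtree Cb b≢c old)
          unique-in b Cb (_ , _ , inj₂ added)       = only-w b added

      cut-off : (∀ u → Added w u ≡ true → u ≡ q) →
        ∀ a b → ¬ Subtree c a ⊎ Subtree cᵢ a → E s′ a b ≡ true → ¬ Subtree c b ⊎ Subtree cᵢ b
      cut-off only-q a b Pa ab with E′⁻ ab | Pa
      ... | _ , (_ , b≢c) , inj₁ old | inj₁ ¬Ca = inj₁ λ Cb → no-entry ¬Ca Cb b≢c old
      ... | _ , (_ , b≢c) , inj₁ old | inj₂ Cᵢa with Gateway.closed γᵢ a b Cᵢa old
      ...   | inj₁ Cᵢb = inj₂ Cᵢb
      ...   | inj₂ b≡c = ⊥-elim (b≢c b≡c)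
      cut-off only-q a b Pa ab | _ , _ , inj₂ added | _ with neighbours (proj₁ (added-local added))
      cut-off only-q a b Pa ab | _ , _ , inj₂ added | _ | inj₁ refl =
        inj₂ (subst (Subtree cᵢ) (sym (only-w b added)) (Gateway.inside γᵢ))
      cut-off only-q a b (inj₁ ¬Ca) ab | _ , _ , inj₂ added | _ | inj₂ (_ , _ , ch , γ , refl) =
        ⊥-elim (¬Ca (rep-in-subtree ch γ))
      cut-off only-q a b (inj₂ Cᵢa) ab | _ , _ , inj₂ added | _ | inj₂ (_ , _ , ch , γ , refl)
        with Gateway.unique γᵢ a Cᵢa (Gateway.edge γ)
      ... | refl = inj₁ λ Cb → q∉subtree (subst (Subtree c) (only-q b added) Cb)

      w-gains-edge : Σ (Fin n) λ u → Added w u ≡ true × u ≢ q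
      w-gains-edge with other-true? (Added w) q
      ... | yes found = found
      ... | no none with others cᵢ
      ... | _ , _ , cⱼ≢cᵢ , chⱼ , γⱼ
        with reaches-every-rep _ (cut-off (only-true none)) (inj₁ q∉subtree) γⱼ
      ... | inj₁ ¬Crⱼ = ⊥-elim (¬Crⱼ (rep-in-subtree chⱼ γⱼ))
      ... | inj₂ Cᵢrⱼ =
        ⊥-elim (siblings-apart chᵢ chⱼ (λ cᵢ≡cⱼ → cⱼ≢cᵢ (sym cᵢ≡cⱼ)) (Gateway.inside γⱼ) Cᵢrⱼ)

    last-deletion : Outcome (suc e) c q h (c ∷ h)
    last-deletion with q-gains-edge
    ... | w , q-w with other-true? (Added q) w
    ... | yes (w′ , q-w′ , w′≢w) = sealed-if-two q-w q-w′ (λ w≡w′ → w′≢w (sym w≡w′))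
    ... | no none with neighbours (proj₁ (proj₂ (added-local q-w)))
    ... | inj₁ w≡q = ⊥-elim (proj₂ (proj₂ (added-local q-w)) (sym w≡q))
    ... | inj₂ (_ , _ , chᵢ , γᵢ , refl) with OneNewEdge.w-gains-edge q-w (only-true none) chᵢ γᵢ
    ... | _ , w-u , u≢q = OneNewEdge.gateway-if-extra q-w (only-true none) chᵢ γᵢ w-u u≢q

  outcome-from : ∀ {e c p h₀ h h′} → degree (net h) p ≡ degree (net h₀) p →
    Outcome e c p h h′ → Outcome e c p h₀ h′
  outcome-from same (win w)          = win w
  outcome-from same (gateway r γ dg) = gateway r γ (subst (_≤ _) same dg)
  outcome-from same (sealed cl dg)   = sealed cl (subst (λ k → suc k ≤ _) same dg)

  parent-row-continues : ∀ {c h h′} → c ≢ root → Continues (λ x → Subtree c x × x ≢ c) h h′ → Valid G A h′ →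
    (∀ b → Subtree c b → E (net h) (parent c) b ≡ true → b ≡ c) → AgreeOn (net h) (net h′) (_≡ parent c)
  parent-row-continues c≢root stop _ _ = agree-refl
  parent-row-continues {c} {h′ = x ∷ h′} c≢root (del (Cx , x≢c) moves) (valid , x-alive) only-c =
    agree-trans row λ { a refl → Deletion.Legal.unaffected h′ x valid x-alive q≢x x≁q }
    where
    row = parent-row-continues c≢root moves valid only-c
    q≢x : parent c ≢ x
    q≢x q≡x = parent∉subtree c≢root (subst (Subtree c) (sym q≡x) Cx)
    x≁q : E (net h′) x (parent c) ≢ true
    x≁q xq = x≢c (only-c x Cx (trans (sym (proj₂ (row (parent c) refl) x)) (trans (E-sym h′ (parent c) x) xq)))

  untouched-initial : ∀ c → Untouched (net []) c
  untouched-initial c a _ = refl , λ _ → refl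

  untouched-children : ∀ {s c cs} → Untouched s c → All (Child c) cs → All (Untouched s) cs
  untouched-children u = All.map λ ch a C′a → u a (child-subtree ch C′a)

  node-wins : ∀ {c h h′ k} → Untouched (net h) c → alive (net h′) c ≡ true → t ≤ k →
    degree (net h) c + k ≤ degree (net h′) c → Win (net h′)
  node-wins {c} {h} {h′} {k} u c-alive t≤k dg = c , c-alive , (begin
    degreeG G c + t      ≤⟨ +-monoʳ-≤ (degreeG G c) t≤k ⟩
    degreeG G c + k      ≡⟨ cong (_+ k) (sym (untouched-degree u)) ⟩
    degree (net h) c + k ≤⟨ dg ⟩
    degree (net h′) c    ∎)

  gateway-wins : ∀ {h c y r} → Gateway (net h) c y t r → Win (net h)
  gateway-wins {h} γ = _ , proj₁ (proj₂ (E⁻ {h} (Gateway.edge γ))) , Gateway.gain γ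

  close-node : ∀ {e c cs h h′} → c ≢ root → Untouched (net h) c → alive (net h) (parent c) ≡ true →
    (∀ b → Subtree c b → b ≢ c → InChildren cs b) → Unique cs → All (Child c) cs →
    Continues (InChildren cs) h h′ → Valid G A h′ → (st : All (Pruned e c (net h′)) cs) → 2 ≤ #inj₁ st →
    Strategy (Subtree c) h (Outcome (suc e) c (parent c) h)
  close-node {e} {c} {cs} {h} {h′} c≢root u q-alive cover uniq chs moves valid st two =
    play (continues-trans (continues-map (in-children-subtree chs) moves) (del (subtree-refl c) stop))
      (valid , c-alive)
      (outcome-from (degree-agree row refl)
        (LastDeletion.last-deletion e c cs h′ c≢root valid c-alive q-alive′ closed′ cover chs st
          (gateways-avoiding uniq chs st two)))
    where
    q-kept : ∀ {x} → InChildren cs x → x ≢ parent c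
    q-kept i x≡q = parent∉subtree c≢root (subst (Subtree c) x≡q (in-children-subtree chs i))
    c-alive : alive (net h′) c ≡ true
    c-alive = alive-continues (continues-map (in-children-≢ chs) moves) valid (proj₁ (u c (subtree-refl c)))
    q-alive′ : alive (net h′) (parent c) ≡ true
    q-alive′ = alive-continues (continues-map q-kept moves) valid q-alive
    closed′ : Closed (net h′) (Subtree c) (parent c)
    closed′ = closed-continues (continues-map q-kept moves) valid (untouched-closed (refl , c≢root) u)
    row : AgreeOn (net h) (net h′) (_≡ parent c)
    row = parent-row-continues c≢root (continues-map (λ i → in-children-subtree chs i , in-children-≢ chs i) moves)
            valid λ b Cb qb → subtree-parent-edge c≢root Cb
                                (trans (sym (proj₂ (u b Cb) (parent c))) (trans (E-sym h b (parent c)) qb))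

  play-subtree : ∀ e c p → Child p c → Complete e c → ∀ h → Valid G A h → Untouched (net h) c →
    alive (net h) p ≡ true → Strategy (Subtree c) h (Outcome e c p h)
  play-subtree zero c p ch (leaf leaf-c) h valid u _ = play stop valid (gateway c γ ≤-refl)
    where
    γ : Gateway (net h) c p 0 c
    γ = record
      { closed = untouched-closed ch u
      ; inside = subtree-refl c
      ; edge   = trans (E-sym h p c) (trans (proj₂ (u c (subtree-refl c)) p) (child-edge ch))
      ; unique = λ b Cb _ → leaf-c b Cb
      ; gain   = ≤-reflexive (trans (+-identityʳ (degreeG G c)) (sym (untouched-degree u)))
      }
  play-subtree (suc e) c _ (refl , c≢root) (node cs len uniq chs comps cover) h valid u q-alive
    with play-children (λ c′ → play-subtree e c′ c) cs uniq chs comps h valid (untouched-children u chs)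
           (proj₁ (u c (subtree-refl c)))
  ... | play moves₁ valid₁ (inj₁ w) = play (continues-map (in-children-subtree chs) moves₁) valid₁ (win w)
  ... | play {h₁} moves₁ valid₁ (inj₂ (st , dg)) with t ≤? #inj₂ st
  ... | yes t≤ =
    play (continues-map (in-children-subtree chs) moves₁) valid₁
      (win (node-wins {h = h} {h₁} u
        (alive-continues (continues-map (in-children-≢ chs) moves₁) valid₁ (proj₁ (u c (subtree-refl c)))) t≤ dg))
  ... | no t≰ with prune cs uniq chs _ valid₁ st
  ... | play moves₂ valid₂ (st′ , same) =
    close-node c≢root u q-alive cover uniq chs (continues-trans moves₁ moves₂) valid₂ st′
      (subst (2 ≤_) (sym same) (two-inj₁ st len t≰))

  win-from-root : Complete (suc t) root → Σ (List (Fin n)) λ h → Valid G A h × Win (net h)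
  win-from-root (node cs len uniq chs comps cover)
    with play-children (λ c′ → play-subtree t c′ root) cs uniq chs comps [] _
           (All.map (λ {c′} _ → untouched-initial c′) chs) refl
  ... | play moves valid (inj₁ w) = _ , valid , w
  ... | play {h} moves valid (inj₂ (st , dg)) with t ≤? #inj₂ st
  ... | yes t≤ =
    h , valid , node-wins {h = []} {h} (untouched-initial root)
                  (alive-continues (continues-map (in-children-≢ chs) moves) valid refl) t≤ dg
  ... | no t≰ with some-inj₁ st (≤-trans (s≤s z≤n) (two-inj₁ st len t≰))
  ... | _ , _ , γ = h , valid , gateway-wins {h} γ

module CompleteTree (t : ℕ) where

  open import Data.Nat using (zero; suc; _+_; _*_; _∸_; _^_; _≤_; _<_; z≤n; s≤s)
  open import Data.Nat.Properties
  open import Data.Nat.DivMod using (_/_; _%_; m/n≤m; m/n*n≤m; m≡m%n+[m/n]*n; m%n<n; +-distrib-/-∣ʳ; m<n⇒m/n≡0; m*n/n≡m)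
  open import Data.Nat.Divisibility using (n∣m*n)
  open import Data.Bool using (true)
  open import Data.Fin using (Fin; zero; suc; toℕ; fromℕ<)
  open import Data.Fin.Properties using (toℕ-injective; toℕ<n; toℕ-fromℕ<; any?) renaming (_≟_ to _≟ᶠ_)
  open import Data.List using (tabulate)
  open import Data.List.Properties using (length-tabulate)
  open import Data.List.Relation.Unary.All.Properties using () renaming (tabulate⁺ to All-tabulate⁺)
  import Data.List.Relation.Unary.Any as Any
  open import Data.List.Relation.Unary.Unique.Propositional.Properties using () renaming (tabulate⁺ to Unique-tabulate⁺)
  open import Data.List.Membership.Propositional using (_∈_)
  open import Data.List.Membership.Propositional.Properties using (∈-tabulate⁺)
  open import Data.Product using (Σ; _×_; _,_; proj₁; proj₂)
  open import Data.Sum using (_⊎_; inj₁; inj₂)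
  import Data.Sum as Sum
  open import Data.Empty using (⊥-elim)
  open import Function using (mk⇔)
  open import Relation.Binary.PropositionalEquality
  open import Relation.Nullary using (¬_; yes; no; Dec; does)
  open import Relation.Nullary.Decidable using (_×-dec_; _⊎-dec_; ¬?; map′; dec-true; dec-false; does-⇔)
  open Counting using (does-true⁻)

  B : ℕ
  B = suc t

  -- Nodes are numbered level by level, so the children of v are v·B + 1, …, v·B + B,
  -- and size d is the number of nodes on the first d levels.
  size : ℕ → ℕ
  size zero    = 0
  size (suc d) = suc (size d * B)

  n : ℕ
  n = size (2 + t)

  parentℕ : ℕ → ℕ
  parentℕ x = (x ∸ 1) / B

  childℕ : ℕ → ℕ → ℕ
  childℕ v j = suc (j + v * B)

  parentℕ-childℕ : ∀ v j → j < B → parentℕ (childℕ v j) ≡ v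
  parentℕ-childℕ v j j<B = trans (+-distrib-/-∣ʳ j (n∣m*n v)) (cong₂ _+_ (m<n⇒m/n≡0 j<B) (m*n/n≡m v B))

  childℕ-parentℕ : ∀ x → childℕ (parentℕ (suc x)) (x % B) ≡ suc x
  childℕ-parentℕ x = cong suc (sym (m≡m%n+[m/n]*n x B))

  parentℕ-≤ : ∀ x → parentℕ x ≤ x ∸ 1
  parentℕ-≤ x = m/n≤m (x ∸ 1) B

  childℕ-≥ : ∀ x → suc (parentℕ (suc x) * B) ≤ suc x
  childℕ-≥ x = s≤s (m/n*n≤m x B)

  childℕ-level : ∀ d v j → size d ≤ v → v < size (suc d) → j < B →
    size (suc d) ≤ childℕ v j × childℕ v j < size (2 + d)
  childℕ-level d v j lo hi j<B =
    s≤s (≤-trans (*-monoˡ-≤ B lo) (m≤n+m (v * B) j)) ,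
    s≤s (≤-trans (+-monoˡ-≤ (v * B) j<B) (*-monoˡ-≤ B hi))

  root : Fin n
  root = zero

  parent : Fin n → Fin n
  parent u = fromℕ< (≤-<-trans (parentℕ-≤ (toℕ u)) (≤-<-trans (m∸n≤m (toℕ u) 1) (toℕ<n u)))

  toℕ-parent : ∀ u → toℕ (parent u) ≡ parentℕ (toℕ u)
  toℕ-parent u = toℕ-fromℕ< _

  parent-root : parent root ≡ root
  parent-root = toℕ-injective (toℕ-parent root)

  parent-≤ : ∀ u → toℕ (parent u) ≤ toℕ u
  parent-≤ u = ≤-trans (≤-reflexive (toℕ-parent u)) (≤-trans (parentℕ-≤ (toℕ u)) (m∸n≤m (toℕ u) 1))

  parent-< : ∀ {u} → u ≢ root → toℕ (parent u) < toℕ u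
  parent-< {zero}  u≢root = ⊥-elim (u≢root refl)
  parent-< {suc u} _      = s≤s (≤-trans (≤-reflexive (toℕ-parent (suc u))) (parentℕ-≤ (suc (toℕ u))))

  child-decomposition : ∀ {u} → u ≢ root → toℕ u ≡ childℕ (toℕ (parent u)) ((toℕ u ∸ 1) % B)
  child-decomposition {zero}  u≢root = ⊥-elim (u≢root refl)
  child-decomposition {suc u} _ =
    trans (sym (childℕ-parentℕ (toℕ u))) (cong (λ p → childℕ p (toℕ u % B)) (sym (toℕ-parent (suc u))))

  child-≥ : ∀ {u} → u ≢ root → suc (toℕ (parent u) * B) ≤ toℕ u
  child-≥ {zero}  u≢root = ⊥-elim (u≢root refl)
  child-≥ {suc u} _ rewrite toℕ-parent (suc u) = childℕ-≥ (toℕ u)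

  child-of-nonroot : ∀ {b u} → u ≢ root → parent b ≡ u → b ≢ root
  child-of-nonroot u≢root pb≡u refl = u≢root (trans (sym pb≡u) parent-root)

  ancestor : ℕ → Fin n → Fin n
  ancestor zero    b = b
  ancestor (suc k) b = ancestor k (parent b)

  ancestor-≤ : ∀ k b → toℕ (ancestor k b) ≤ toℕ b
  ancestor-≤ zero    b = ≤-refl
  ancestor-≤ (suc k) b = ≤-trans (ancestor-≤ k (parent b)) (parent-≤ b)

  ancestor-suc : ∀ k b → ancestor (suc k) b ≡ parent (ancestor k b)
  ancestor-suc zero    b = refl
  ancestor-suc (suc k) b = ancestor-suc k (parent b)

  ancestor-+ : ∀ i m b → ancestor (i + m) b ≡ ancestor m (ancestor i b)
  ancestor-+ zero    m b = refl
  ancestor-+ (suc i) m b = ancestor-+ i m (parent b)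

  ancestor-root : ∀ k b → toℕ b ≤ k → ancestor k b ≡ root
  ancestor-root zero    zero    _ = refl
  ancestor-root (suc k) b       b≤k =
    ancestor-root k (parent b)
      (≤-trans (≤-reflexive (toℕ-parent b)) (≤-trans (parentℕ-≤ (toℕ b)) (∸-monoˡ-≤ 1 b≤k)))

  Subtree : Fin n → Fin n → Set
  Subtree c b = Σ ℕ λ k → ancestor k b ≡ c

  -- Ancestors stabilise at the root after toℕ b steps, so a bounded search decides Subtree.
  subtree? : ∀ c b → Dec (Subtree c b)
  subtree? c b = map′ (λ (k , eq) → toℕ k , eq) bounded (any? λ (k : Fin (suc (toℕ b))) → ancestor (toℕ k) b ≟ᶠ c)
    where
    bounded : Subtree c b → Σ (Fin (suc (toℕ b))) λ k → ancestor (toℕ k) b ≡ c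
    bounded (k , eq) with k ≤? toℕ b
    ... | yes k≤b = fromℕ< (s≤s k≤b) , trans (cong (λ i → ancestor i b) (toℕ-fromℕ< (s≤s k≤b))) eq
    ... | no  k≰b = fromℕ< (n<1+n (toℕ b)) ,
      trans (cong (λ i → ancestor i b) (toℕ-fromℕ< (n<1+n (toℕ b))))
        (trans (ancestor-root (toℕ b) b ≤-refl) (trans (sym (ancestor-root k b (<⇒≤ (≰⇒> k≰b)))) eq))

  ChildOf : Fin n → Fin n → Set
  ChildOf a b = a ≢ root × parent a ≡ b

  Edge : Fin n → Fin n → Set
  Edge a b = ChildOf a b ⊎ ChildOf b a

  edge? : ∀ a b → Dec (Edge a b)
  edge? a b = (¬? (a ≟ᶠ root) ×-dec (parent a ≟ᶠ b)) ⊎-dec (¬? (b ≟ᶠ root) ×-dec (parent b ≟ᶠ a))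

  G : Adj n
  G a b = does (edge? a b)

  G-sym : Symmetric G
  G-sym a b = does-⇔ (mk⇔ Sum.swap Sum.swap) (edge? a b) (edge? b a)

  G-irrefl : Irreflexive G
  G-irrefl a = dec-false (edge? a a) λ
    { (inj₁ (a≢root , pa≡a)) → <-irrefl (cong toℕ pa≡a) (parent-< a≢root)
    ; (inj₂ (a≢root , pa≡a)) → <-irrefl (cong toℕ pa≡a) (parent-< a≢root) }

  parent-edge : ∀ {c} → c ≢ root → G c (parent c) ≡ true
  parent-edge {c} c≢root = dec-true (edge? c (parent c)) (inj₁ (c≢root , refl))

  parent∉subtree : ∀ {c} → c ≢ root → ¬ Subtree c (parent c)
  parent∉subtree {c} c≢root (k , eq) =
    <-irrefl refl (≤-<-trans (≤-trans (≤-reflexive (cong toℕ (sym eq))) (ancestor-≤ k (parent c))) (parent-< c≢root))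

  ancestor-of-sibling : ∀ {c₁ c₂} → parent c₁ ≡ parent c₂ → c₂ ≢ root → ∀ m → ancestor m c₁ ≡ c₂ → c₁ ≡ c₂
  ancestor-of-sibling _ _ zero eq = eq
  ancestor-of-sibling {c₁} {c₂} p₁≡p₂ c₂≢root (suc m) refl =
    ⊥-elim (<-irrefl refl (≤-<-trans c₂≤p₂ (parent-< c₂≢root)))
    where
    c₂≤p₂ : toℕ (ancestor m (parent c₁)) ≤ toℕ (parent (ancestor m (parent c₁)))
    c₂≤p₂ = subst (λ p → toℕ (ancestor m (parent c₁)) ≤ toℕ p) p₁≡p₂ (ancestor-≤ m (parent c₁))

  siblings-ordered : ∀ {c₁ c₂ b i j} → parent c₁ ≡ parent c₂ → c₂ ≢ root → i ≤ j →
    ancestor i b ≡ c₁ → ancestor j b ≡ c₂ → c₁ ≡ c₂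
  siblings-ordered {b = b} {i} p₁≡p₂ c₂≢root i≤j eq₁ eq₂ with m≤n⇒∃[o]m+o≡n i≤j
  ... | m , refl =
    ancestor-of-sibling p₁≡p₂ c₂≢root m (trans (cong (ancestor m) (sym eq₁)) (trans (sym (ancestor-+ i m b)) eq₂))

  siblings-disjoint : ∀ {c₁ c₂ b} → parent c₁ ≡ parent c₂ → c₁ ≢ root → c₂ ≢ root →
    Subtree c₁ b → Subtree c₂ b → c₁ ≡ c₂
  siblings-disjoint p₁≡p₂ c₁≢root c₂≢root (i , eq₁) (j , eq₂) with ≤-total i j
  ... | inj₁ i≤j = siblings-ordered p₁≡p₂ c₂≢root i≤j eq₁ eq₂
  ... | inj₂ j≤i = sym (siblings-ordered (sym p₁≡p₂) c₁≢root j≤i eq₂ eq₁)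

  subtree-exit : ∀ {c a b} → c ≢ root → Subtree c a → G a b ≡ true → Subtree c b ⊎ b ≡ parent c
  subtree-exit {c} {a} {b} _ (k , eq) ab with does-true⁻ (edge? a b) ab
  ... | inj₁ (_ , pa≡b) with k
  ...   | zero  = inj₂ (trans (sym pa≡b) (cong parent eq))
  ...   | suc m = inj₁ (m , trans (cong (ancestor m) (sym pa≡b)) eq)
  subtree-exit {c} {a} {b} _ (k , eq) ab | inj₂ (_ , pb≡a) = inj₁ (suc k , trans (cong (ancestor k) pb≡a) eq)

  subtree-parent-edge : ∀ {c b} → c ≢ root → Subtree c b → G b (parent c) ≡ true → b ≡ c
  subtree-parent-edge {c} {b} c≢root Cb bq with does-true⁻ (edge? b (parent c)) bq
  ... | inj₁ (b≢root , pb≡pc) = siblings-disjoint pb≡pc b≢root c≢root (0 , refl) Cb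
  ... | inj₂ (_ , ppc≡b) with Cb
  ...   | k , eq = ⊥-elim (<-irrefl refl (≤-<-trans c≤pc (parent-< c≢root)))
    where
    c≤pc : toℕ c ≤ toℕ (parent c)
    c≤pc = begin
      toℕ c                     ≡⟨ cong toℕ (sym eq) ⟩
      toℕ (ancestor k b)        ≤⟨ ancestor-≤ k b ⟩
      toℕ b                     ≡⟨ cong toℕ (sym ppc≡b) ⟩
      toℕ (parent (parent c))   ≤⟨ parent-≤ (parent c) ⟩
      toℕ (parent c)            ∎
      where open ≤-Reasoning

  tree : RootedTree G
  tree = record
    { root                = root
    ; parent              = parent
    ; Subtree             = Subtree
    ; subtree?            = subtree?
    ; subtree-refl        = λ c → 0 , refl
    ; subtree-parent      = λ { {b = b} _ (k , eq) → suc k , trans (ancestor-suc k b) (cong parent eq) }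
    ; parent∉subtree      = parent∉subtree
    ; siblings-disjoint   = siblings-disjoint
    ; parent-edge         = parent-edge
    ; subtree-exit        = subtree-exit
    ; subtree-parent-edge = subtree-parent-edge
    }

  open Branching tree t using (Child; InChildren; Complete; leaf; node)

  positive-nonroot : ∀ {u} → 0 < toℕ u → u ≢ root
  positive-nonroot () refl

  leaf-subtree : ∀ {u} → size (suc t) ≤ toℕ u → ∀ b → Subtree u b → b ≡ u
  leaf-subtree lo b (zero , eq) = eq
  leaf-subtree lo b (suc k , eq) with leaf-subtree lo (parent b) (k , eq)
  ... | refl = ⊥-elim (<-irrefl refl (<-≤-trans (toℕ<n b)
                 (≤-trans (s≤s (*-monoˡ-≤ B lo)) (child-≥ b≢root))))
    where
    b≢root : b ≢ root
    b≢root = child-of-nonroot (positive-nonroot (≤-trans (s≤s z≤n) lo)) refl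

  size-mono : ∀ {d d′} → d ≤ d′ → size d ≤ size d′
  size-mono z≤n       = z≤n
  size-mono (s≤s d≤d′) = s≤s (*-monoˡ-≤ B (size-mono d≤d′))

  module Children (d : ℕ) (d≤t : d ≤ t) (u : Fin n) (lo : size d ≤ toℕ u) (hi : toℕ u < size (suc d)) where

    child-bound : ∀ (j : Fin B) → childℕ (toℕ u) (toℕ j) < n
    child-bound j = <-≤-trans (proj₂ (childℕ-level d (toℕ u) (toℕ j) lo hi (toℕ<n j))) (size-mono (s≤s (s≤s d≤t)))

    child : Fin B → Fin n
    child j = fromℕ< (child-bound j)

    toℕ-child : ∀ j → toℕ (child j) ≡ childℕ (toℕ u) (toℕ j)
    toℕ-child j = toℕ-fromℕ< (child-bound j)

    child-injective : ∀ {i j} → child i ≡ child j → i ≡ j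
    child-injective {i} {j} eq = toℕ-injective (+-cancelʳ-≡ (toℕ u * B) (toℕ i) (toℕ j)
      (suc-injective (trans (sym (toℕ-child i)) (trans (cong toℕ eq) (toℕ-child j)))))

    child-level : ∀ j → size (suc d) ≤ toℕ (child j) × toℕ (child j) < size (2 + d)
    child-level j rewrite toℕ-child j = childℕ-level d (toℕ u) (toℕ j) lo hi (toℕ<n j)

    child-is-child : ∀ j → Child u (child j)
    child-is-child j =
      toℕ-injective (trans (toℕ-parent (child j))
                      (trans (cong parentℕ (toℕ-child j)) (parentℕ-childℕ (toℕ u) (toℕ j) (toℕ<n j)))) ,
      positive-nonroot (subst (0 <_) (sym (toℕ-child j)) (s≤s z≤n))

    child-∈ : ∀ {w} → w ≢ root → parent w ≡ u → w ∈ tabulate child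
    child-∈ {w} w≢root pw≡u = subst (_∈ tabulate child) (sym w≡child) (∈-tabulate⁺ {f = child} j)
      where
      j : Fin B
      j = fromℕ< (m%n<n (toℕ w ∸ 1) B)
      w≡child : w ≡ child j
      w≡child = toℕ-injective (begin
        toℕ w                                        ≡⟨ child-decomposition w≢root ⟩
        childℕ (toℕ (parent w)) ((toℕ w ∸ 1) % B)    ≡⟨ cong₂ childℕ (cong toℕ pw≡u) (sym (toℕ-fromℕ< _)) ⟩
        childℕ (toℕ u) (toℕ j)                       ≡⟨ toℕ-child j ⟨
        toℕ (child j)                                ∎)
        where open ≡-Reasoning

    cover : ∀ k b → ancestor k b ≡ u → b ≢ u → InChildren (tabulate child) b
    cover zero    b eq b≢u = ⊥-elim (b≢u eq)
    cover (suc k) b eq b≢u with parent b ≟ᶠ u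
    ... | no pb≢u = Any.map (λ (k′ , eq′) → suc k′ , eq′) (cover k (parent b) eq pb≢u)
    ... | yes pb≡u = Any.map (λ b≡c′ → 0 , b≡c′) (child-∈ b≢root pb≡u)
      where
      b≢root : b ≢ root
      b≢root refl = b≢u (trans (sym parent-root) pb≡u)

  complete : ∀ e d u → e + d ≡ suc t → size d ≤ toℕ u → toℕ u < size (suc d) → Complete e u
  complete zero    d u refl lo hi = leaf (leaf-subtree lo)
  complete (suc e) d u eq   lo hi =
    node (tabulate child) (length-tabulate child) (Unique-tabulate⁺ child-injective) (All-tabulate⁺ child-is-child)
      (All-tabulate⁺ λ j →
         complete e (suc d) (child j) (trans (+-suc e d) eq) (proj₁ (child-level j)) (proj₂ (child-level j)))
      λ b (k , eq′) b≢u → cover k b eq′ b≢u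
    where open Children d (≤-trans (m≤n+m d e) (≤-reflexive (suc-injective eq))) u lo hi

  root-complete : Complete (suc t) root
  root-complete = complete (suc t) 0 root (+-identityʳ (suc t)) z≤n (s≤s z≤n)

  to-root : ∀ k u → toℕ u < k → Reach (initial G) u root
  to-root (suc k) u u<k with u ≟ᶠ root
  ... | yes refl   = here
  ... | no u≢root = step (parent-edge u≢root) (to-root k (parent u) (≤-trans (parent-< u≢root) (≤-pred u<k)))

  G-connected : Connected (initial G)
  G-connected = connected-via G-sym root λ u → to-root n u (toℕ<n u)

  size-≥ : ∀ d → d ≤ size d
  size-≥ zero    = z≤n
  size-≥ (suc d) = s≤s (≤-trans (size-≥ d) (m≤m*n (size d) B))

  size-< : 2 ≤ B → ∀ d → size d < B ^ d
  size-< 2≤B zero    = s≤s z≤n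
  size-< 2≤B (suc d) = begin-strict
    suc (size d * B)      <⟨ +-monoˡ-≤ (size d * B) 2≤B ⟩
    B + size d * B        ≡⟨ *-comm (suc (size d)) B ⟩
    B * suc (size d)      ≤⟨ *-monoʳ-≤ B (size-< 2≤B d) ⟩
    B * B ^ d             ∎
    where open ≤-Reasoning

module LogBound where

  open import Data.Nat using (zero; suc; _+_; _*_; _^_; _≤_; _<_; z≤n; s≤s)
  open import Data.Nat.Properties
  open import Data.Nat.Logarithm using (⌈log₂_⌉; ⌈log₂⌉-mono-≤; ⌈log₂2^n⌉≡n)
  open import Data.Nat.Tactic.RingSolver using (solve-∀)
  open import Relation.Binary.PropositionalEquality
  open import Relation.Nullary.Decidable using (toWitness)
  open ≤-Reasoning

  n<2^n : ∀ k → k < 2 ^ k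
  n<2^n zero    = s≤s z≤n
  n<2^n (suc k) = begin-strict
    suc k           <⟨ s≤s (n<2^n k) ⟩
    suc (2 ^ k)     ≤⟨ +-monoˡ-≤ (2 ^ k) (m^n>0 2 k) ⟩
    2 ^ k + 2 ^ k   ≡⟨ cong (2 ^ k +_) (sym (+-identityʳ (2 ^ k))) ⟩
    2 ^ suc k       ∎

  quadratic≤2^ : ∀ k → (6 + k) * (8 + k) ≤ 2 ^ (6 + k)
  quadratic≤2^ zero    = toWitness {a? = 48 ≤? 64} _
  quadratic≤2^ (suc k) = begin
    (6 + suc k) * (8 + suc k)               ≡⟨ expand k ⟩
    (6 + k) * (8 + k) + (2 * k + 15)        ≤⟨ +-monoʳ-≤ ((6 + k) * (8 + k)) increment ⟩
    (6 + k) * (8 + k) + (6 + k) * (8 + k)   ≤⟨ +-mono-≤ (quadratic≤2^ k) (quadratic≤2^ k) ⟩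
    2 ^ (6 + k) + 2 ^ (6 + k)               ≡⟨ cong (2 ^ (6 + k) +_) (sym (+-identityʳ (2 ^ (6 + k)))) ⟩
    2 ^ (6 + suc k)                         ∎
    where
    expand : ∀ k → (6 + suc k) * (8 + suc k) ≡ (6 + k) * (8 + k) + (2 * k + 15)
    expand = solve-∀
    split : ∀ k → (6 + k) * (8 + k) ≡ (2 * k + 15) + (k * k + 12 * k + 33)
    split = solve-∀
    increment : 2 * k + 15 ≤ (6 + k) * (8 + k)
    increment = ≤-trans (m≤m+n (2 * k + 15) _) (≤-reflexive (sym (split k)))

  log-log-bound : ∀ t m → m ≤ suc t ^ (2 + t) → t * (2 + t) ≤ 2 ^ t → ⌈log₂ ⌈log₂ m ⌉ ⌉ ≤ t
  log-log-bound t m m≤ quadratic = begin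
    ⌈log₂ ⌈log₂ m ⌉ ⌉               ≤⟨ ⌈log₂⌉-mono-≤ (⌈log₂⌉-mono-≤ m≤2^) ⟩
    ⌈log₂ ⌈log₂ 2 ^ (t * (2 + t)) ⌉ ⌉ ≡⟨ cong ⌈log₂_⌉ (⌈log₂2^n⌉≡n (t * (2 + t))) ⟩
    ⌈log₂ (t * (2 + t)) ⌉           ≤⟨ ⌈log₂⌉-mono-≤ quadratic ⟩
    ⌈log₂ 2 ^ t ⌉                   ≡⟨ ⌈log₂2^n⌉≡n t ⟩
    t                               ∎
    where
    m≤2^ : m ≤ 2 ^ (t * (2 + t))
    m≤2^ = ≤-trans m≤ (≤-trans (^-monoˡ-≤ (2 + t) (n<2^n t)) (≤-reflexive (^-*-assoc 2 t (2 + t))))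

open LogBound using (log-log-bound; quadratic≤2^)

theorem2p3 : (N : ℕ) → Σ ℕ λ n → N ≤ n × Σ (Adj n) λ G →
    Symmetric G × Irreflexive G × Connected (initial G) ×
    ((A : Healer n) → LocalityAware G A → KeepsConnected G A →
      Σ (List (Fin n)) λ h → Valid G A h × Σ (Fin n) λ v →
        alive (run G A h) v ≡ true ×
        degreeG G v + ⌈log₂ ⌈log₂ n ⌉ ⌉ ≤ degree (run G A h) v)
theorem2p3 N = n , N≤n , G , G-sym , G-irrefl , G-connected , forced-degree
  where
  open CompleteTree (6 + N)
  N≤n : N ≤ n
  N≤n = ≤-trans (m≤n+m N 8) (size-≥ (8 + N))
  log-log-n≤t : ⌈log₂ ⌈log₂ n ⌉ ⌉ ≤ 6 + N
  log-log-n≤t = log-log-bound (6 + N) n (<⇒≤ (size-< (s≤s (s≤s z≤n)) (8 + N))) (quadratic≤2^ N)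
  forced-degree : (A : Healer n) → LocalityAware G A → KeepsConnected G A →
    Σ (List (Fin n)) λ h → Valid G A h × Σ (Fin n) λ v →
      alive (run G A h) v ≡ true × degreeG G v + ⌈log₂ ⌈log₂ n ⌉ ⌉ ≤ degree (run G A h) v
  forced-degree A local connected =
    let h , valid , v , v-alive , gain =
          Adversary.win-from-root G G-sym G-irrefl A local connected (6 + N) tree root-complete
    in  h , valid , v , v-alive , ≤-trans (+-monoʳ-≤ (degreeG G v) log-log-n≤t) gain
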